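{- Let $\mathcal{L}$ be a $\Sigma$-additive category with total sums, and let $(\mathbin{\&}_{i\in I}X_i,(p_i)_{i\in I})$ be a categorical product of a countable family $(X_i)_{i\in I}$ of objects. For $i\in I$ let $\iota_i\in\mathcal{L}(X_i,\mathbin{\&}_{j\in I}X_j)$ be the unique morphism with $p_j\circ\iota_i=\mathrm{id}_{X_i}$ if $j=i$ and $p_j\circ\iota_i=0$ otherwise. Then $\sum_{i\in I}\iota_i\circ p_i=\mathrm{id}$, and $(\mathbin{\&}_{i\in I}X_i,(\iota_i)_{i\in I})$ is a coproduct of $(X_i)_{i\in I}$, the copairing of $(f_i\in\mathcal{L}(X_i,Y))_{i\in I}$ being $\sum_{i\in I}f_i\circ p_i$. In other words, every countable cartesian product in $\mathcal{L}$ is a countable biproduct.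
   Context: $e\sqsubseteq e'$: if $e$ is defined then $e'$ is defined and equal; $e\simeq e'$: one side defined iff the other is, and then equal. $\Sigma$-monoid: nonempty set with a partial operation $\Sigma$ on families indexed by at most countable sets (families in the domain are summable) such that every one-element family $x$ is summable with sum $x$ and, for every family $(x_a)_{a\in A}$ and partition $(A_i)_{i\in I}$ of $A$ ($I$ at most countable, parts possibly empty), $\sum_{a\in A}x_a\simeq\sum_{i\in I}\sum_{a\in A_i}x_a$. The empty sum is written $0$. A $\Sigma$-additive category is a category whose hom-sets are $\Sigma$-monoids such that $(\sum_b g_b)\circ f\sqsubseteq\sum_b(g_b\circ f)$ and $h\circ(\sum_a f_a)\sqsubseteq\sum_a(h\circ f_a)$ for all morphisms and families. It has total sums if every family in every hom-set is summable. -}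

module Defs where

open import Level using (Level; _⊔_) renaming (suc to lsuc; zero to lzero)
open import Data.Nat using (ℕ)
open import Data.Empty using (⊥)
open import Data.Product using (Σ; ∃; _×_; _,_)
open import Function.Bundles using (_↣_)
open import Relation.Binary.PropositionalEquality using (_≡_)
open import Relation.Nullary using (¬_)

AtMostCountable : Set → Set
AtMostCountable A = A ↣ ℕ

-- The partial operation Σ is given as its graph:
-- 'HasSum x s' means the family x is summable with sum s.  Only families
-- indexed by at most countable sets are meaningful; all axioms quantify
-- over those.
record SigmaMonoid (M : Set) : Set₁ where
  field
    HasSum : {A : Set} → (A → M) → M → Set
    HasSum-functional : {A : Set} → AtMostCountable A →
      (x : A → M) {s t : M} → HasSum x s → HasSum x t → s ≡ t
    HasSum-singleton : {A : Set} (x : A → M) (a : A) →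
      (∀ b → b ≡ a) → HasSum x (x a)
    -- partition associativity  Σ_{a∈A} x_a ≃ Σ_{i∈I} Σ_{a∈A_i} x_a ,
    -- the partition (A_i)_{i∈I} given by the map π : A → I, with
    -- A_i = { a | π a ≡ i } (parts possibly empty).
    HasSum-partition⇒ : {A I : Set} → AtMostCountable A → AtMostCountable I →
      (x : A → M) (π : A → I) {s : M} → HasSum x s →
      Σ (I → M) λ t →
        (∀ i → HasSum {Σ A (λ a → π a ≡ i)} (λ { (a , _) → x a }) (t i))
        × HasSum t s
    HasSum-partition⇐ : {A I : Set} → AtMostCountable A → AtMostCountable I →
      (x : A → M) (π : A → I) (t : I → M) {s : M} →
      (∀ i → HasSum {Σ A (λ a → π a ≡ i)} (λ { (a , _) → x a }) (t i)) →
      HasSum t s → HasSum x s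

  IsZero : M → Set
  IsZero m = HasSum {⊥} (λ ()) m

record Category (o : Level) : Set (lsuc (o ⊔ lzero)) where
  infixr 9 _∘_
  field
    Obj : Set o
    Hom : Obj → Obj → Set
    id  : {X : Obj} → Hom X X
    _∘_ : {X Y Z : Obj} → Hom Y Z → Hom X Y → Hom X Z
    identityˡ : {X Y : Obj} (f : Hom X Y) → id ∘ f ≡ f
    identityʳ : {X Y : Obj} (f : Hom X Y) → f ∘ id ≡ f
    assoc : {W X Y Z : Obj} (h : Hom Y Z) (g : Hom X Y) (f : Hom W X) →
      (h ∘ g) ∘ f ≡ h ∘ (g ∘ f)

record SigmaAdditiveCategory (o : Level) : Set (lsuc o) where
  field
    cat : Category o
  open Category cat public
  field
    homMonoid : (X Y : Obj) → SigmaMonoid (Hom X Y)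

  HasSum : {X Y : Obj} {A : Set} → (A → Hom X Y) → Hom X Y → Set
  HasSum {X} {Y} = SigmaMonoid.HasSum (homMonoid X Y)

  field
    precomp-sum : {X Y Z : Obj} {B : Set} → AtMostCountable B →
      (g : B → Hom Y Z) (f : Hom X Y) {s : Hom Y Z} →
      HasSum g s → HasSum (λ b → g b ∘ f) (s ∘ f)
    postcomp-sum : {X Y Z : Obj} {A : Set} → AtMostCountable A →
      (h : Hom Y Z) (f : A → Hom X Y) {s : Hom X Y} →
      HasSum f s → HasSum (λ a → h ∘ f a) (h ∘ s)

  IsZero : {X Y : Obj} → Hom X Y → Set
  IsZero {X} {Y} = SigmaMonoid.IsZero (homMonoid X Y)

  HasTotalSums : Set (o ⊔ lsuc lzero)
  HasTotalSums = {X Y : Obj} {A : Set} → AtMostCountable A →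
    (f : A → Hom X Y) → ∃ λ s → HasSum f s

  IsProduct : {I : Set} (X : I → Obj) (P : Obj) (p : (i : I) → Hom P (X i)) → Set o
  IsProduct {I} X P p = (Y : Obj) (f : (i : I) → Hom Y (X i)) →
    Σ (Hom Y P) λ h → (∀ i → p i ∘ h ≡ f i)
      × (∀ g → (∀ i → p i ∘ g ≡ f i) → g ≡ h)

  IsCoproduct : {I : Set} (X : I → Obj) (C : Obj) (ι : (i : I) → Hom (X i) C) → Set o
  IsCoproduct {I} X C ι = (Y : Obj) (f : (i : I) → Hom (X i) Y) →
    Σ (Hom C Y) λ h → (∀ i → h ∘ ι i ≡ f i)
      × (∀ g → (∀ i → g ∘ ι i ≡ f i) → g ≡ h)

-- Since pⱼ ∘ ιᵢ = 0 for i ≠ j, composing Σᵢ aᵢ ∘ pᵢ with ιⱼ, or pⱼ with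
-- Σᵢ ιᵢ ∘ bᵢ, kills every summand but the j-th one.  Hence
-- pⱼ ∘ Σᵢ ιᵢ ∘ pᵢ = pⱼ for every j, so Σᵢ ιᵢ ∘ pᵢ = id by the universal property
-- of the product.  Likewise (Σᵢ fᵢ ∘ pᵢ) ∘ ιⱼ = fⱼ, and any g with g ∘ ιᵢ = fᵢ
-- equals g ∘ Σᵢ ιᵢ ∘ pᵢ = Σᵢ fᵢ ∘ pᵢ, which makes P a coproduct.
module Submission where

open import Defs
open import Level using (Level)
open import Data.Empty using (⊥; ⊥-elim)
open import Data.Nat.Properties using (eq?)
open import Data.Product using (Σ; _×_; _,_)
open import Data.Unit using (⊤; tt)
open import Function.Bundles using (mk↣)
open import Relation.Binary.PropositionalEquality
  using (_≡_; refl; sym; trans; cong; subst; module ≡-Reasoning)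
open import Relation.Nullary using (¬_; Irrelevant; yes; no)

irrelevant⇒atMostCountable : {A : Set} → Irrelevant A → AtMostCountable A
irrelevant⇒atMostCountable irr = mk↣ {to = λ _ → 0} (λ {a} {b} _ → irr a b)

empty⇒atMostCountable : {E : Set} → (E → ⊥) → AtMostCountable E
empty⇒atMostCountable e = irrelevant⇒atMostCountable (λ a → ⊥-elim (e a))

⊥-atMostCountable : AtMostCountable ⊥
⊥-atMostCountable = empty⇒atMostCountable λ ()

module SigmaMonoidProperties {M : Set} (S : SigmaMonoid M) where
  open SigmaMonoid S

  IsZero-unique : {a b : M} → IsZero a → IsZero b → a ≡ b
  IsZero-unique = HasSum-functional ⊥-atMostCountable (λ ())

  HasSum-empty⇒IsZero : {E : Set} → (E → ⊥) → (g : E → M) {s : M} →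
    HasSum g s → IsZero s
  HasSum-empty⇒IsZero e g =
    HasSum-partition⇐ ⊥-atMostCountable (empty⇒atMostCountable e)
      (λ ()) (λ ()) g (λ a → ⊥-elim (e a))

  HasSum-cong : {A : Set} → AtMostCountable A → {x y : A → M} →
    (∀ a → x a ≡ y a) → {s : M} → HasSum y s → HasSum x s
  HasSum-cong {A} cA {x} {y} x≗y = HasSum-partition⇐ cA cA x (λ a → a) y fibre
    where
    fibre : ∀ i → HasSum {Σ A (λ a → a ≡ i)} (λ { (a , _) → x a }) (y i)
    fibre i = subst (HasSum _) (x≗y i)
      (HasSum-singleton _ (i , refl) λ { (a , refl) → refl })

  -- The one-element family g j, partitioned along the constant map to j, has a
  -- fibre sum at every i; these fibre sums are g j at j and 0 elsewhere, so they
  -- agree with g and their total is g j.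
  HasSum-concentrated : {I : Set} → AtMostCountable I → (g : I → M) (j : I) →
    (∀ i → ¬ (i ≡ j) → IsZero (g i)) → HasSum g (g j)
  HasSum-concentrated {I} cI g j zero-off-j
    with HasSum-partition⇒ (irrelevant⇒atMostCountable λ _ _ → refl) cI
           (λ (_ : ⊤) → g j) (λ _ → j) (HasSum-singleton _ tt λ _ → refl)
  ... | t , fibre , sum-t = HasSum-cong cI g≗t sum-t
    where
    g≗t : ∀ i → g i ≡ t i
    g≗t i with eq? cI i j
    ... | yes refl = HasSum-functional
      (irrelevant⇒atMostCountable λ { (tt , refl) (tt , refl) → refl }) _
      (HasSum-singleton _ (tt , refl) λ { (tt , refl) → refl }) (fibre j)
    ... | no i≢j = IsZero-unique (zero-off-j i i≢j)
      (HasSum-empty⇒IsZero (λ { (tt , j≡i) → i≢j (sym j≡i) }) _ (fibre i))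

module SigmaAdditiveCategoryProperties {o : Level} (𝓛 : SigmaAdditiveCategory o) where
  open SigmaAdditiveCategory 𝓛
  open ≡-Reasoning
  module HomSum (A B : Obj) = SigmaMonoidProperties (homMonoid A B)

  IsZero-∘ʳ : {A B C : Obj} {z : Hom B C} (f : Hom A B) → IsZero z → IsZero (z ∘ f)
  IsZero-∘ʳ {A} {B} {C} f z≈0 =
    HomSum.HasSum-empty⇒IsZero A C (λ x → x) _ (precomp-sum ⊥-atMostCountable (λ ()) f z≈0)

  IsZero-∘ˡ : {A B C : Obj} {z : Hom A B} (h : Hom B C) → IsZero z → IsZero (h ∘ z)
  IsZero-∘ˡ {A} {B} {C} h z≈0 =
    HomSum.HasSum-empty⇒IsZero A C (λ x → x) _ (postcomp-sum ⊥-atMostCountable h (λ ()) z≈0)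

  product-jointly-monic : {I : Set} {X : I → Obj} {P : Obj} {p : (i : I) → Hom P (X i)} →
    IsProduct X P p → {Y : Obj} {g h : Hom Y P} → (∀ i → p i ∘ g ≡ p i ∘ h) → g ≡ h
  product-jointly-monic {p = p} product {Y} {h = h} p∘g≡p∘h
    with product Y (λ i → p i ∘ h)
  ... | _ , _ , unique = trans (unique _ p∘g≡p∘h) (sym (unique h λ _ → refl))

  module BiproductEquations
    {I : Set} (cI : AtMostCountable I)
    {X : I → Obj} {P : Obj} (p : (i : I) → Hom P (X i)) (ι : (i : I) → Hom (X i) P)
    (p∘ι≡id : ∀ i → p i ∘ ι i ≡ id)
    (p∘ι≈0 : ∀ i j → ¬ (j ≡ i) → IsZero (p j ∘ ι i))
    where

    sum-unique : {A B : Obj} (x : I → Hom A B) {s t : Hom A B} →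
      HasSum x s → HasSum x t → s ≡ t
    sum-unique {A} {B} = SigmaMonoid.HasSum-functional (homMonoid A B) cI

    p∘sum-ι∘p : {s : Hom P P} → HasSum (λ i → ι i ∘ p i) s → ∀ j → p j ∘ s ≡ p j
    p∘sum-ι∘p sum j = sum-unique _ (postcomp-sum cI (p j) _ sum)
      (subst (HasSum _) p∘ι∘p≡p
        (HomSum.HasSum-concentrated P (X j) cI (λ i → p j ∘ (ι i ∘ p i)) j
          λ i i≢j → subst IsZero (assoc _ _ _)
            (IsZero-∘ʳ (p i) (p∘ι≈0 i j λ j≡i → i≢j (sym j≡i)))))
      where
      p∘ι∘p≡p : p j ∘ (ι j ∘ p j) ≡ p j
      p∘ι∘p≡p = begin
        p j ∘ (ι j ∘ p j) ≡⟨ sym (assoc _ _ _) ⟩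
        (p j ∘ ι j) ∘ p j ≡⟨ cong (_∘ p j) (p∘ι≡id j) ⟩
        id ∘ p j          ≡⟨ identityˡ _ ⟩
        p j               ∎

    sum-∘p∘ι : {Y : Obj} (f : (i : I) → Hom (X i) Y) {c : Hom P Y} →
      HasSum (λ i → f i ∘ p i) c → ∀ j → c ∘ ι j ≡ f j
    sum-∘p∘ι f sum j = sum-unique _ (precomp-sum cI _ (ι j) sum)
      (subst (HasSum _) f∘p∘ι≡f
        (HomSum.HasSum-concentrated (X j) _ cI (λ i → (f i ∘ p i) ∘ ι j) j
          λ i i≢j → subst IsZero (sym (assoc _ _ _))
            (IsZero-∘ˡ (f i) (p∘ι≈0 j i i≢j))))
      where
      f∘p∘ι≡f : (f j ∘ p j) ∘ ι j ≡ f j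
      f∘p∘ι≡f = begin
        (f j ∘ p j) ∘ ι j ≡⟨ assoc _ _ _ ⟩
        f j ∘ (p j ∘ ι j) ≡⟨ cong (f j ∘_) (p∘ι≡id j) ⟩
        f j ∘ id          ≡⟨ identityʳ _ ⟩
        f j               ∎

    copairing-unique : HasSum (λ i → ι i ∘ p i) id →
      {Y : Obj} (f : (i : I) → Hom (X i) Y) {c : Hom P Y} → HasSum (λ i → f i ∘ p i) c →
      (g : Hom P Y) → (∀ i → g ∘ ι i ≡ f i) → g ≡ c
    copairing-unique sum-id {Y} f {c} sum-f g g∘ι≡f = begin
      g      ≡⟨ sym (identityʳ g) ⟩
      g ∘ id ≡⟨ sum-unique _ (HomSum.HasSum-cong P Y cI g∘ι∘p≡f∘p (postcomp-sum cI g _ sum-id)) sum-f ⟩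
      c      ∎
      where
      g∘ι∘p≡f∘p : ∀ i → f i ∘ p i ≡ g ∘ (ι i ∘ p i)
      g∘ι∘p≡f∘p i = trans (cong (_∘ p i) (sym (g∘ι≡f i))) (assoc _ _ _)

mainTheorem14 : {o : Level} (𝓛 : SigmaAdditiveCategory o) →
    let open SigmaAdditiveCategory 𝓛 in
    HasTotalSums →
    {I : Set} → AtMostCountable I →
    (X : I → Obj) (P : Obj) (p : (i : I) → Hom P (X i)) →
    IsProduct X P p →
    (ι : (i : I) → Hom (X i) P) →
    (∀ i → p i ∘ ι i ≡ id) →
    (∀ i j → ¬ (j ≡ i) → IsZero (p j ∘ ι i)) →
    HasSum (λ i → ι i ∘ p i) id
    × IsCoproduct X P ι
    × ((Y : Obj) (f : (i : I) → Hom (X i) Y) (c : Hom P Y) →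
         HasSum (λ i → f i ∘ p i) c → ∀ i → c ∘ ι i ≡ f i)
mainTheorem14 𝓛 total cI X P p product ι p∘ι≡id p∘ι≈0 =
  sum-id , coproduct , λ Y f c → sum-∘p∘ι f
  where
  open SigmaAdditiveCategory 𝓛
  open SigmaAdditiveCategoryProperties 𝓛
  open BiproductEquations cI p ι p∘ι≡id p∘ι≈0

  sum-id : HasSum (λ i → ι i ∘ p i) id
  sum-id with total cI (λ i → ι i ∘ p i)
  ... | s , sum = subst (HasSum _)
    (product-jointly-monic product λ j → trans (p∘sum-ι∘p sum j) (sym (identityʳ _))) sum

  coproduct : IsCoproduct X P ι
  coproduct Y f with total cI (λ i → f i ∘ p i)
  ... | c , sum = c , sum-∘p∘ι f sum , λ g → copairing-unique sum-id f sum g
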